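{- Let $G$ and $H$ be connected graphs, each of order at least $2$. If $G \,\square\, H$ is well-dominated, then $\gamma(G \,\square\, H)=\gamma(G)\cdot n(H)=\gamma(H)\cdot n(G)$.
   Context: All graphs are finite, simple and undirected; $n(X)$ is the order of $X$. $\gamma(X)$ is the minimum size of a dominating set (a set $D$ such that every vertex is in $D$ or adjacent to a vertex of $D$), $\Gamma(X)$ the maximum size of an inclusion-minimal dominating set; $X$ is well-dominated if $\gamma(X)=\Gamma(X)$. The Cartesian product $G\,\square\, H$ has vertex set $V(G)\times V(H)$, with $(g_1,h_1)\sim(g_2,h_2)$ iff either $g_1=g_2$ and $h_1h_2\in E(H)$, or $h_1=h_2$ and $g_1g_2\in E(G)$. -}

module Defs where

open import Data.Nat using (ℕ; _*_; _≤_)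
open import Data.Bool using (Bool; true; false; _∧_; _∨_)
open import Data.Fin using (Fin; remQuot)
open import Data.Fin.Properties using (_≟_)
open import Data.Fin.Subset using (Subset; _∈_; _⊂_; ∣_∣)
open import Data.Product using (Σ; ∃; _×_; _,_)
open import Data.Sum using (_⊎_)
open import Relation.Nullary using (¬_)
open import Relation.Nullary.Decidable using (⌊_⌋)
open import Relation.Binary.PropositionalEquality using (_≡_)

record Graph : Set where
  field
    n   : ℕ
    adj : Fin n → Fin n → Bool

open Graph public

order : Graph → ℕ
order X = n X

Adj : (X : Graph) → Fin (n X) → Fin (n X) → Set
Adj X u v = adj X u v ≡ true

IsSimple : Graph → Set
IsSimple X = (∀ u v → adj X u v ≡ adj X v u) × (∀ v → adj X v v ≡ false)

data Reachable (X : Graph) : Fin (n X) → Fin (n X) → Set where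
  here : ∀ {v} → Reachable X v v
  step : ∀ {u v w} → Adj X u v → Reachable X v w → Reachable X u w

Connected : Graph → Set
Connected X = ∀ u v → Reachable X u v

-- Cartesian product G □ H, vertices (g , h) encoded as Fin (n G * n H) via remQuot
_□_ : Graph → Graph → Graph
G □ H = record
  { n   = n G * n H
  ; adj = λ x y → prodAdj (remQuot (n H) x) (remQuot (n H) y)
  }
  where
  prodAdj : Fin (n G) × Fin (n H) → Fin (n G) × Fin (n H) → Bool
  prodAdj (g₁ , h₁) (g₂ , h₂) =
    (⌊ g₁ ≟ g₂ ⌋ ∧ adj H h₁ h₂) ∨ (⌊ h₁ ≟ h₂ ⌋ ∧ adj G g₁ g₂)

Dominating : (X : Graph) → Subset (n X) → Set
Dominating X D = ∀ v → v ∈ D ⊎ ∃ (λ u → u ∈ D × Adj X u v)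

MinimalDominating : (X : Graph) → Subset (n X) → Set
MinimalDominating X D = Dominating X D × (∀ D′ → D′ ⊂ D → ¬ Dominating X D′)

IsDominationNumber : Graph → ℕ → Set
IsDominationNumber X k =
  Σ (Subset (n X)) (λ D → Dominating X D × ∣ D ∣ ≡ k)
  × (∀ D → Dominating X D → k ≤ ∣ D ∣)

IsUpperDominationNumber : Graph → ℕ → Set
IsUpperDominationNumber X k =
  Σ (Subset (n X)) (λ D → MinimalDominating X D × ∣ D ∣ ≡ k)
  × (∀ D → MinimalDominating X D → ∣ D ∣ ≤ k)

WellDominated : Graph → Set
WellDominated X = ∀ a b → IsDominationNumber X a → IsUpperDominationNumber X b → a ≡ b

-- By the Bollobás–Cockayne lemma, a graph without isolated vertices has a
-- minimum dominating set D in which every vertex d has an external private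
-- neighbour y (adjacent to d, outside D, and adjacent to no other vertex of D).
-- Then D × V(H) is a minimal dominating set of G □ H: removing (d , h) leaves
-- (y , h) undominated, since its only neighbours in D × V(H) lie in the same
-- H-layer over a D-neighbour of y, that is, over d.  In a well-dominated graph
-- every minimal dominating set is minimum, so γ(G □ H) = |D × V(H)| = γ(G) n(H),
-- and symmetrically γ(G □ H) = n(G) γ(H).
module Submission where

open import Defs
open import Data.Bool using (T; _∧_)
import Data.Bool as Bool
open import Data.Bool.Properties using (T-≡; T-∨; T-∧)
open import Data.Fin using (Fin; zero; remQuot; combine; punchIn)
open import Data.Fin.Properties using (_≟_; any?; all?; remQuot-combine; combine-remQuot; punchInᵢ≢i)
open import Data.Fin.Subset using (Subset; inside; outside; _∈_; _∉_; _⊆_; _⊂_; _∩_; _∪_; _-_; ⁅_⁆; ∣_∣)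
open import Data.Fin.Subset.Properties using (_∈?_; _⊂?_; anySubset?; ∣p∣≤n; ∣⊤∣≡n; ∣⊥∣≡0; ∣⁅x⁆∣≡1; x∈⁅x⁆; x∈p∩q⁺; x∈p∩q⁻; p⊆p∪q; q⊆p∪q; x∈p∧x≢y⇒x∈p-y; x∈p⇒∣p-x∣<∣p∣; p⊂q⇒∣p∣<∣q∣; ⊆-refl)
open import Data.Nat using (ℕ; zero; suc; _+_; _*_; _≤_; _<_; _≤?_; _<?_; s≤s)
open import Data.Nat.Properties using (≤-refl; ≤-reflexive; ≤-trans; ≤-antisym; m≤n⇒m≤1+n; <-≤-trans; <⇒≱; ≮⇒≥; <-irrefl; m≤m+n; +-suc; +-comm; +-monoʳ-≤; *-comm; module ≤-Reasoning)
open import Data.Product using (∃; _×_; _,_; proj₁; proj₂)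
import Data.Product as Product
open import Data.Sum using (_⊎_; inj₁; inj₂)
import Data.Sum as Sum
open import Data.Vec using (_∷_; []; _++_; lookup; tabulate; replicate; map; concat)
open import Data.Vec.Properties using (lookup∘tabulate; []=⇒lookup; lookup⇒[]=; lookup-concat; lookup-map; lookup-replicate)
open import Function using (_∘_; _⇔_; mk⇔; Equivalence)
open import Relation.Nullary using (¬_; Dec; yes; no; does; contradiction)
open import Relation.Nullary.Decidable using (_×-dec_; _⊎-dec_; _→-dec_; ¬?; map′; ⌊_⌋; toWitness; fromWitness; dec-true; decidable-stable)
open import Relation.Binary.PropositionalEquality using (_≡_; _≢_; refl; sym; trans; cong; cong₂; subst; subst₂; module ≡-Reasoning)

open Equivalence

Vertex : Graph → Set
Vertex X = Fin (n X)

∣p∪q∣≤∣p∣+∣q∣ : ∀ {m} (p q : Subset m) → ∣ p ∪ q ∣ ≤ ∣ p ∣ + ∣ q ∣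
∣p∪q∣≤∣p∣+∣q∣ [] [] = ≤-refl
∣p∪q∣≤∣p∣+∣q∣ (outside ∷ p) (outside ∷ q) = ∣p∪q∣≤∣p∣+∣q∣ p q
∣p∪q∣≤∣p∣+∣q∣ (outside ∷ p) (inside ∷ q) = ≤-trans (s≤s (∣p∪q∣≤∣p∣+∣q∣ p q)) (≤-reflexive (sym (+-suc ∣ p ∣ ∣ q ∣)))
∣p∪q∣≤∣p∣+∣q∣ (inside ∷ p) (outside ∷ q) = s≤s (∣p∪q∣≤∣p∣+∣q∣ p q)
∣p∪q∣≤∣p∣+∣q∣ (inside ∷ p) (inside ∷ q) = s≤s (≤-trans (∣p∪q∣≤∣p∣+∣q∣ p q) (+-monoʳ-≤ ∣ p ∣ (m≤n⇒m≤1+n ≤-refl)))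

module _ {m : ℕ} where

  decSubset : {P : Fin m → Set} → (∀ i → Dec (P i)) → Subset m
  decSubset P? = tabulate (does ∘ P?)

  ∈-decSubset⁺ : ∀ {P : Fin m → Set} (P? : ∀ i → Dec (P i)) {i} → P i → i ∈ decSubset P?
  ∈-decSubset⁺ P? {i} p = lookup⇒[]= i _ (trans (lookup∘tabulate _ i) (dec-true (P? i) p))

  ∈-decSubset⁻ : ∀ {P : Fin m → Set} (P? : ∀ i → Dec (P i)) {i} → i ∈ decSubset P? → P i
  ∈-decSubset⁻ P? {i} i∈ with P? i | trans (sym (lookup∘tabulate (does ∘ P?) i)) ([]=⇒lookup i∈)
  ... | yes p | _ = p
  ... | no _  | ()

  module _ {B : ℕ} {P : Subset m → Set} (P? : ∀ D → Dec (P D)) (f : Subset m → ℕ) (f≤B : ∀ D → f D ≤ B) where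

    maximiser : ∀ {D} → P D → ∃ λ M → P M × (∀ D′ → P D′ → f D′ ≤ f M)
    maximiser {D} pD = climb B D pD (m≤m+n B (f D))
      where
      climb : ∀ k D → P D → B ≤ k + f D → ∃ λ M → P M × (∀ D′ → P D′ → f D′ ≤ f M)
      climb k D pD B≤k+fD with anySubset? (λ D′ → P? D′ ×-dec f D <? f D′)
      ... | no noBetter = D , pD , λ D′ pD′ → ≮⇒≥ (λ fD<fD′ → noBetter (D′ , pD′ , fD<fD′))
      ... | yes (D′ , pD′ , fD<fD′) with k
      ...   | zero  = contradiction (<-≤-trans fD<fD′ (≤-trans (f≤B D′) B≤k+fD)) (<-irrefl refl)
      ...   | suc k = climb k D′ pD′ (≤-trans B≤k+fD (≤-trans (≤-reflexive (sym (+-suc k (f D)))) (+-monoʳ-≤ k fD<fD′)))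

Dominates : (X : Graph) → Subset (n X) → Vertex X → Set
Dominates X D v = v ∈ D ⊎ ∃ λ u → u ∈ D × Adj X u v

dominates-mono : ∀ {X D D′ v} → D ⊆ D′ → Dominates X D v → Dominates X D′ v
dominates-mono D⊆D′ = Sum.map D⊆D′ (Product.map₂ (Product.map₁ D⊆D′))

module _ (X : Graph) where

  adj? : ∀ u v → Dec (Adj X u v)
  adj? u v = adj X u v Bool.≟ Bool.true

  adjacentTo? : ∀ D v → Dec (∃ λ u → u ∈ D × Adj X u v)
  adjacentTo? D v = any? λ u → u ∈? D ×-dec adj? u v

  dominating? : ∀ D → Dec (Dominating X D)
  dominating? D = all? λ v → v ∈? D ⊎-dec adjacentTo? D v

  minimalDominating? : ∀ D → Dec (MinimalDominating X D)
  minimalDominating? D = dominating? D ×-dec map′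
    (λ noSmaller D′ D′⊂D dom′ → noSmaller (D′ , D′⊂D , dom′))
    (λ noSmaller (D′ , D′⊂D , dom′) → noSmaller D′ D′⊂D dom′)
    (¬? (anySubset? λ D′ → D′ ⊂? D ×-dec dominating? D′))

  upperDominationNumber-exists : ∀ {D} → MinimalDominating X D → ∃ (IsUpperDominationNumber X)
  upperDominationNumber-exists minD with maximiser minimalDominating? ∣_∣ ∣p∣≤n minD
  ... | M , minM , maximal = ∣ M ∣ , (M , minM , refl) , maximal

  wellDominated⇒∣minimal∣≡γ : ∀ {a D} → WellDominated X → IsDominationNumber X a → MinimalDominating X D → ∣ D ∣ ≡ a
  wellDominated⇒∣minimal∣≡γ {a} {D} wd γ@(_ , minimum) minD@(domD , _) with upperDominationNumber-exists minD
  ... | Γ , isΓ@(_ , maximal) = ≤-antisym (subst (∣ D ∣ ≤_) (sym (wd a Γ γ isΓ)) (maximal D minD)) (minimum D domD)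

  neighbourhood : Subset (n X) → Subset (n X)
  neighbourhood D = decSubset (adjacentTo? D)

  ∈-neighbourhood⁺ : ∀ {D u v} → u ∈ D → Adj X u v → v ∈ neighbourhood D
  ∈-neighbourhood⁺ {D} u∈D u~v = ∈-decSubset⁺ (adjacentTo? D) (_ , u∈D , u~v)

  ∈-neighbourhood⁻ : ∀ {D v} → v ∈ neighbourhood D → ∃ λ u → u ∈ D × Adj X u v
  ∈-neighbourhood⁻ {D} = ∈-decSubset⁻ (adjacentTo? D)

  nonIsolated : Subset (n X) → Subset (n X)
  nonIsolated D = D ∩ neighbourhood D

  nonIsolated-mono : ∀ {D D′} → D ⊆ D′ → nonIsolated D ⊆ nonIsolated D′
  nonIsolated-mono {D} D⊆D′ v∈ with x∈p∩q⁻ D _ v∈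
  ... | v∈D , v∈N with ∈-neighbourhood⁻ v∈N
  ...   | u , u∈D , u~v = x∈p∩q⁺ (D⊆D′ v∈D , ∈-neighbourhood⁺ (D⊆D′ u∈D) u~v)

  IsExternalPrivateNeighbour : Subset (n X) → Vertex X → Vertex X → Set
  IsExternalPrivateNeighbour D d y = y ∉ D × Adj X d y × (∀ u → u ∈ D → Adj X u y → u ≡ d)

  HasExternalPrivateNeighbour : Subset (n X) → Vertex X → Set
  HasExternalPrivateNeighbour D d = ∃ (IsExternalPrivateNeighbour D d)

  hasExternalPrivateNeighbour? : ∀ D d → Dec (HasExternalPrivateNeighbour D d)
  hasExternalPrivateNeighbour? D d = any? λ y →
    ¬? (y ∈? D) ×-dec adj? d y ×-dec all? λ u → u ∈? D →-dec (adj? u y →-dec u ≟ d)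

  module _ {D d} (dom : Dominating X D) (noEPN : ¬ HasExternalPrivateNeighbour D d) where

    ∉⇒dominatedWithout-d : ∀ {v} → v ∉ D → ∃ λ w → w ∈ D - d × Adj X w v
    ∉⇒dominatedWithout-d {v} v∉D with any? (λ w → w ∈? D - d ×-dec adj? w v)
    ... | yes found = found
    ... | no none with dom v
    ...   | inj₁ v∈D = contradiction v∈D v∉D
    ...   | inj₂ (u , u∈D , u~v) = contradiction (v , v∉D , subst (λ w → Adj X w v) (onlyD u u∈D u~v) u~v , onlyD) noEPN
      where
      onlyD : ∀ u → u ∈ D → Adj X u v → u ≡ d
      onlyD u u∈D u~v = decidable-stable (u ≟ d) λ u≢d → none (u , x∈p∧x≢y⇒x∈p-y u∈D u≢d , u~v)

    -- Only d itself may fail to be dominated by D - d.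
    noEPN⇒dominating : ∀ {D′} → D - d ⊆ D′ → Dominates X D′ d → Dominating X D′
    noEPN⇒dominating D-d⊆D′ d-dominated v with v ≟ d | v ∈? D
    ... | yes refl | _        = d-dominated
    ... | no v≢d   | yes v∈D  = inj₁ (D-d⊆D′ (x∈p∧x≢y⇒x∈p-y v∈D v≢d))
    ... | no v≢d   | no v∉D   = dominates-mono {X} D-d⊆D′ (inj₂ (∉⇒dominatedWithout-d v∉D))

module _ {X : Graph} (simple : IsSimple X) where

  adj-sym : ∀ {u v} → Adj X u v → Adj X v u
  adj-sym {u} {v} u~v = trans (proj₁ simple v u) u~v

  adj⇒≢ : ∀ {u v} → Adj X u v → u ≢ v
  adj⇒≢ {u} u~u refl with trans (sym u~u) (proj₂ simple u)
  ... | ()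

  isolated⇒nonIsolated[D]⊆nonIsolated[D-d] : ∀ {D d} → ¬ (∃ λ u → u ∈ D × Adj X u d) → nonIsolated X D ⊆ nonIsolated X (D - d)
  isolated⇒nonIsolated[D]⊆nonIsolated[D-d] {D} {d} isolated {v} v∈ with x∈p∩q⁻ D _ v∈
  ... | v∈D , v∈N with ∈-neighbourhood⁻ X v∈N
  ...   | u , u∈D , u~v = x∈p∩q⁺ (x∈p∧x≢y⇒x∈p-y v∈D v≢d , ∈-neighbourhood⁺ X (x∈p∧x≢y⇒x∈p-y u∈D u≢d) u~v)
    where
    v≢d : v ≢ d
    v≢d refl = isolated (u , u∈D , u~v)
    u≢d : u ≢ d
    u≢d refl = isolated (v , v∈D , adj-sym u~v)

NoIsolatedVertices : Graph → Set
NoIsolatedVertices X = ∀ v → ∃ (Adj X v)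

-- Bollobás–Cockayne: among the minimum dominating sets, one maximising the number
-- of non-isolated vertices of its induced subgraph gives every vertex an external
-- private neighbour.  Otherwise the offending vertex is either redundant or, being
-- isolated, can be swapped for a neighbour to increase that number.
module _ {X : Graph} (simple : IsSimple X) (noIsolated : NoIsolatedVertices X) where

  module _ {b D d} (minimum : ∀ D′ → Dominating X D′ → b ≤ ∣ D′ ∣) (dom : Dominating X D) (∣D∣≤b : ∣ D ∣ ≤ b)
           (d∈D : d ∈ D) (noEPN : ¬ HasExternalPrivateNeighbour X D d) where

    noEPN⇒isolated : ¬ (∃ λ u → u ∈ D × Adj X u d)
    noEPN⇒isolated (u , u∈D , u~d) = <⇒≱ (<-≤-trans (x∈p⇒∣p-x∣<∣p∣ d∈D) ∣D∣≤b) (minimum (D - d) D-d-dominating)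
      where
      D-d-dominating : Dominating X (D - d)
      D-d-dominating = noEPN⇒dominating X dom noEPN ⊆-refl (inj₂ (u , x∈p∧x≢y⇒x∈p-y u∈D (adj⇒≢ simple u~d) , u~d))

    noEPN⇒improvable : ∃ λ D′ → (Dominating X D′ × ∣ D′ ∣ ≤ b) × ∣ nonIsolated X D ∣ < ∣ nonIsolated X D′ ∣
    noEPN⇒improvable = D′ , (dom′ , ∣D′∣≤b) , p⊂q⇒∣p∣<∣q∣ (nonIsolated⊆ , y , y∈nonIsolated′ , y∉D ∘ proj₁ ∘ x∈p∩q⁻ D _)
      where
      y : Vertex X
      y = proj₁ (noIsolated d)
      d~y : Adj X d y
      d~y = proj₂ (noIsolated d)
      y∉D : y ∉ D
      y∉D y∈D = noEPN⇒isolated (y , y∈D , adj-sym simple d~y)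
      D′ : Subset (n X)
      D′ = (D - d) ∪ ⁅ y ⁆
      D-d⊆D′ : D - d ⊆ D′
      D-d⊆D′ = p⊆p∪q ⁅ y ⁆
      y∈D′ : y ∈ D′
      y∈D′ = q⊆p∪q (D - d) ⁅ y ⁆ (x∈⁅x⁆ y)
      dom′ : Dominating X D′
      dom′ = noEPN⇒dominating X dom noEPN D-d⊆D′ (inj₂ (y , y∈D′ , adj-sym simple d~y))
      ∣D′∣≤b : ∣ D′ ∣ ≤ b
      ∣D′∣≤b = begin
        ∣ D′ ∣                  ≤⟨ ∣p∪q∣≤∣p∣+∣q∣ (D - d) ⁅ y ⁆ ⟩
        ∣ D - d ∣ + ∣ ⁅ y ⁆ ∣   ≡⟨ cong (∣ D - d ∣ +_) (∣⁅x⁆∣≡1 y) ⟩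
        ∣ D - d ∣ + 1           ≡⟨ +-comm ∣ D - d ∣ 1 ⟩
        suc ∣ D - d ∣           ≤⟨ x∈p⇒∣p-x∣<∣p∣ d∈D ⟩
        ∣ D ∣                   ≤⟨ ∣D∣≤b ⟩
        b                       ∎
        where open ≤-Reasoning
      nonIsolated⊆ : nonIsolated X D ⊆ nonIsolated X D′
      nonIsolated⊆ = nonIsolated-mono X D-d⊆D′ ∘ isolated⇒nonIsolated[D]⊆nonIsolated[D-d] simple noEPN⇒isolated
      y∈nonIsolated′ : y ∈ nonIsolated X D′
      y∈nonIsolated′ with ∉⇒dominatedWithout-d X dom noEPN y∉D
      ... | w , w∈D-d , w~y = x∈p∩q⁺ (y∈D′ , ∈-neighbourhood⁺ X (D-d⊆D′ w∈D-d) w~y)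

  minimumDominating-withExternalPrivateNeighbours : ∀ {b} → IsDominationNumber X b →
    ∃ λ D → Dominating X D × ∣ D ∣ ≡ b × (∀ d → d ∈ D → HasExternalPrivateNeighbour X D d)
  minimumDominating-withExternalPrivateNeighbours {b} ((D₀ , dom₀ , ∣D₀∣≡b) , minimum)
    with maximiser (λ D → dominating? X D ×-dec ∣ D ∣ ≤? b) (∣_∣ ∘ nonIsolated X) (∣p∣≤n ∘ nonIsolated X)
                   (dom₀ , ≤-reflexive ∣D₀∣≡b)
  ... | D , (dom , ∣D∣≤b) , maximal = D , dom , ≤-antisym ∣D∣≤b (minimum D dom) , everyEPN
    where
    everyEPN : ∀ d → d ∈ D → HasExternalPrivateNeighbour X D d
    everyEPN d d∈D with hasExternalPrivateNeighbour? X D d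
    ... | yes epn  = epn
    ... | no noEPN with noEPN⇒improvable minimum dom ∣D∣≤b d∈D noEPN
    ...   | D′ , candidate , better = contradiction (maximal D′ candidate) (<⇒≱ better)

anotherVertex : ∀ {m} → 2 ≤ m → (v : Fin m) → ∃ (v ≢_)
anotherVertex (s≤s (s≤s _)) v = punchIn v zero , punchInᵢ≢i v zero ∘ sym

connected⇒noIsolatedVertices : ∀ {X} → Connected X → 2 ≤ order X → NoIsolatedVertices X
connected⇒noIsolatedVertices {X} connected 2≤n v with anotherVertex 2≤n v
... | w , v≢w = firstStep (connected v w) v≢w
  where
  firstStep : ∀ {u w} → Reachable X u w → u ≢ w → ∃ (Adj X u)
  firstStep here           u≢u = contradiction refl u≢u
  firstStep (step u~v _)   _   = _ , u~v

-- X has vertex set V(K) × L, via π, σ and ι; each edge of X either stays in a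
-- K-fibre or joins (i , j) to (i′ , j) with i ~ i′, and all of the latter are
-- edges.  Both G □ H over G and G □ H over H are of this form.
module Layered (X K : Graph) {L : Set}
  (π : Vertex X → Vertex K) (σ : Vertex X → L) (ι : Vertex K → L → Vertex X)
  (π-ι : ∀ i j → π (ι i j) ≡ i) (σ-ι : ∀ i j → σ (ι i j) ≡ j) (ι-π-σ : ∀ x → ι (π x) (σ x) ≡ x)
  (adj⁻ : ∀ {x y} → Adj X x y → π x ≡ π y ⊎ (σ x ≡ σ y × Adj K (π x) (π y)))
  (adj⁺ : ∀ {i i′} j → Adj K i i′ → Adj X (ι i j) (ι i′ j))
  (D : Subset (n K)) (A : Subset (n X)) (lookup-A : ∀ i j → lookup A (ι i j) ≡ lookup D i) where

  ∈A⁺ : ∀ {i} j → i ∈ D → ι i j ∈ A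
  ∈A⁺ {i} j i∈D = lookup⇒[]= (ι i j) A (trans (lookup-A i j) ([]=⇒lookup i∈D))

  ∈A⁻ : ∀ {x} → x ∈ A → π x ∈ D
  ∈A⁻ {x} x∈A = lookup⇒[]= (π x) D (begin
    lookup D (π x)          ≡⟨ sym (lookup-A (π x) (σ x)) ⟩
    lookup A (ι (π x) (σ x)) ≡⟨ cong (lookup A) (ι-π-σ x) ⟩
    lookup A x              ≡⟨ []=⇒lookup x∈A ⟩
    inside                  ∎)
    where open ≡-Reasoning

  dominating : Dominating K D → Dominating X A
  dominating domD x with domD (π x)
  ... | inj₁ πx∈D = inj₁ (subst (_∈ A) (ι-π-σ x) (∈A⁺ (σ x) πx∈D))
  ... | inj₂ (u , u∈D , u~πx) = inj₂ (ι u (σ x) , ∈A⁺ (σ x) u∈D , subst (Adj X (ι u (σ x))) (ι-π-σ x) (adj⁺ (σ x) u~πx))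

  minimalDominating : Dominating K D → (∀ d → d ∈ D → HasExternalPrivateNeighbour K D d) → MinimalDominating X A
  minimalDominating domD epn = dominating domD , noSmaller
    where
    noSmaller : ∀ A′ → A′ ⊂ A → ¬ Dominating X A′
    noSmaller A′ (A′⊆A , z , z∈A , z∉A′) domA′ with epn (π z) (∈A⁻ z∈A)
    ... | y , y∉D , _ , onlyπz with domA′ (ι y (σ z))
    ...   | inj₁ y′∈A′ = y∉D (subst (_∈ D) (π-ι y (σ z)) (∈A⁻ (A′⊆A y′∈A′)))
    ...   | inj₂ (x , x∈A′ , x~y′) with adj⁻ x~y′
    ...     | inj₁ πx≡ = y∉D (subst (_∈ D) (trans πx≡ (π-ι y (σ z))) (∈A⁻ (A′⊆A x∈A′)))
    ...     | inj₂ (σx≡ , πx~) = z∉A′ (subst (_∈ A′) x≡z x∈A′)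
      where
      x≡z : x ≡ z
      x≡z = begin
        x                 ≡⟨ sym (ι-π-σ x) ⟩
        ι (π x) (σ x)     ≡⟨ cong₂ ι (onlyπz (π x) (∈A⁻ (A′⊆A x∈A′)) (subst (Adj K (π x)) (π-ι y (σ z)) πx~))
                                     (trans σx≡ (σ-ι y (σ z))) ⟩
        ι (π z) (σ z)     ≡⟨ ι-π-σ z ⟩
        z                 ∎
        where open ≡-Reasoning

∣p++q∣≡∣p∣+∣q∣ : ∀ {m k} (p : Subset m) (q : Subset k) → ∣ p ++ q ∣ ≡ ∣ p ∣ + ∣ q ∣
∣p++q∣≡∣p∣+∣q∣ []            q = refl
∣p++q∣≡∣p∣+∣q∣ (inside ∷ p)  q = cong suc (∣p++q∣≡∣p∣+∣q∣ p q)
∣p++q∣≡∣p∣+∣q∣ (outside ∷ p) q = ∣p++q∣≡∣p∣+∣q∣ p q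

-- D × Fin k and Fin m × D, as subsets of Fin (m * k) under combine.
_×ᶠ_ : ∀ {m} → Subset m → (k : ℕ) → Subset (m * k)
D ×ᶠ k = concat (map (replicate k) D)

_ᶠ×_ : ∀ {k} (m : ℕ) → Subset k → Subset (m * k)
m ᶠ× D = concat (replicate m D)

lookup-×ᶠ : ∀ {m k} (D : Subset m) i (j : Fin k) → lookup (D ×ᶠ k) (combine i j) ≡ lookup D i
lookup-×ᶠ {k = k} D i j = begin
  lookup (concat (map (replicate k) D)) (combine i j) ≡⟨ lookup-concat (map (replicate k) D) i j ⟩
  lookup (lookup (map (replicate k) D) i) j          ≡⟨ cong (λ xs → lookup xs j) (lookup-map i (replicate k) D) ⟩
  lookup (replicate k (lookup D i)) j                ≡⟨ lookup-replicate j (lookup D i) ⟩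
  lookup D i                                         ∎
  where open ≡-Reasoning

lookup-ᶠ× : ∀ {m k} (D : Subset k) (i : Fin m) j → lookup (m ᶠ× D) (combine i j) ≡ lookup D j
lookup-ᶠ× {m} D i j = trans (lookup-concat (replicate m D) i j) (cong (λ xs → lookup xs j) (lookup-replicate i D))

∣×ᶠ∣ : ∀ {m} (D : Subset m) k → ∣ D ×ᶠ k ∣ ≡ ∣ D ∣ * k
∣×ᶠ∣ []            k = refl
∣×ᶠ∣ (inside ∷ D)  k = trans (∣p++q∣≡∣p∣+∣q∣ (replicate k inside) (D ×ᶠ k)) (cong₂ _+_ (∣⊤∣≡n k) (∣×ᶠ∣ D k))
∣×ᶠ∣ (outside ∷ D) k = trans (∣p++q∣≡∣p∣+∣q∣ (replicate k outside) (D ×ᶠ k)) (cong₂ _+_ (∣⊥∣≡0 k) (∣×ᶠ∣ D k))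

∣ᶠ×∣ : ∀ {k} m (D : Subset k) → ∣ m ᶠ× D ∣ ≡ m * ∣ D ∣
∣ᶠ×∣ zero    D = refl
∣ᶠ×∣ (suc m) D = trans (∣p++q∣≡∣p∣+∣q∣ D (m ᶠ× D)) (cong (∣ D ∣ +_) (∣ᶠ×∣ m D))

module CartesianProduct (G H : Graph) where

  fst : Vertex (G □ H) → Vertex G
  fst x = proj₁ (remQuot {n G} (n H) x)

  snd : Vertex (G □ H) → Vertex H
  snd x = proj₂ (remQuot {n G} (n H) x)

  fst-combine : ∀ g h → fst (combine g h) ≡ g
  fst-combine g h = cong proj₁ (remQuot-combine {n G} {n H} g h)

  snd-combine : ∀ g h → snd (combine g h) ≡ h
  snd-combine g h = cong proj₂ (remQuot-combine {n G} {n H} g h)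

  combine-fst-snd : ∀ x → combine (fst x) (snd x) ≡ x
  combine-fst-snd = combine-remQuot {n G} (n H)

  adj-□⇔ : ∀ {x y} → Adj (G □ H) x y ⇔
    ((fst x ≡ fst y × Adj H (snd x) (snd y)) ⊎ (snd x ≡ snd y × Adj G (fst x) (fst y)))
  adj-□⇔ {x} {y} = mk⇔ decode encode
    where
    unpack : ∀ {A : Set} (a? : Dec A) {b} → T (⌊ a? ⌋ ∧ b) → A × b ≡ Bool.true
    unpack a? = Product.map toWitness (to T-≡) ∘ to T-∧
    pack : ∀ {A : Set} (a? : Dec A) {b} → A × b ≡ Bool.true → T (⌊ a? ⌋ ∧ b)
    pack a? (a , b≡true) = from T-∧ (fromWitness a , from T-≡ b≡true)
    decode : Adj (G □ H) x y → (fst x ≡ fst y × Adj H (snd x) (snd y)) ⊎ (snd x ≡ snd y × Adj G (fst x) (fst y))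
    decode x~y = Sum.map (unpack (fst x ≟ fst y)) (unpack (snd x ≟ snd y)) (to T-∨ (from T-≡ x~y))
    encode : (fst x ≡ fst y × Adj H (snd x) (snd y)) ⊎ (snd x ≡ snd y × Adj G (fst x) (fst y)) → Adj (G □ H) x y
    encode = to T-≡ ∘ from T-∨ ∘ Sum.map (pack (fst x ≟ fst y)) (pack (snd x ≟ snd y))

  private
    module OverG = Layered (G □ H) G fst snd combine fst-combine snd-combine combine-fst-snd
      (Sum.map₁ proj₁ ∘ to adj-□⇔)
      (λ {g} {g′} h g~g′ → from adj-□⇔ (inj₂ (trans (snd-combine g h) (sym (snd-combine g′ h)) ,
                                              subst₂ (Adj G) (sym (fst-combine g h)) (sym (fst-combine g′ h)) g~g′)))

    module OverH = Layered (G □ H) H snd fst (λ h g → combine g h) (λ h g → snd-combine g h) (λ h g → fst-combine g h) combine-fst-snd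
      (Sum.swap ∘ Sum.map₂ proj₁ ∘ to adj-□⇔)
      (λ {h} {h′} g h~h′ → from adj-□⇔ (inj₁ (trans (fst-combine g h) (sym (fst-combine g h′)) ,
                                              subst₂ (Adj H) (sym (snd-combine g h)) (sym (snd-combine g h′)) h~h′)))

  wellDominated⇒γ≡γˡ*n : IsSimple G → NoIsolatedVertices G → WellDominated (G □ H) →
    ∀ {a b} → IsDominationNumber (G □ H) a → IsDominationNumber G b → a ≡ b * n H
  wellDominated⇒γ≡γˡ*n simple noIsolated wd {a} {b} γ□ γG
    with minimumDominating-withExternalPrivateNeighbours simple noIsolated γG
  ... | D , dom , ∣D∣≡b , epn = begin
    a             ≡⟨ sym (wellDominated⇒∣minimal∣≡γ (G □ H) wd γ□
                       (OverG.minimalDominating D (D ×ᶠ n H) (lookup-×ᶠ D) dom epn)) ⟩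
    ∣ D ×ᶠ n H ∣  ≡⟨ ∣×ᶠ∣ D (n H) ⟩
    ∣ D ∣ * n H   ≡⟨ cong (_* n H) ∣D∣≡b ⟩
    b * n H       ∎
    where open ≡-Reasoning

  wellDominated⇒γ≡n*γʳ : IsSimple H → NoIsolatedVertices H → WellDominated (G □ H) →
    ∀ {a c} → IsDominationNumber (G □ H) a → IsDominationNumber H c → a ≡ n G * c
  wellDominated⇒γ≡n*γʳ simple noIsolated wd {a} {c} γ□ γH
    with minimumDominating-withExternalPrivateNeighbours simple noIsolated γH
  ... | D , dom , ∣D∣≡c , epn = begin
    a             ≡⟨ sym (wellDominated⇒∣minimal∣≡γ (G □ H) wd γ□
                       (OverH.minimalDominating D (n G ᶠ× D) (λ h g → lookup-ᶠ× D g h) dom epn)) ⟩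
    ∣ n G ᶠ× D ∣  ≡⟨ ∣ᶠ×∣ (n G) D ⟩
    n G * ∣ D ∣   ≡⟨ cong (n G *_) ∣D∣≡c ⟩
    n G * c       ∎
    where open ≡-Reasoning

proposition3 : (G H : Graph) → IsSimple G → IsSimple H
    → Connected G → Connected H → 2 ≤ order G → 2 ≤ order H
    → WellDominated (G □ H)
    → ∀ a b c → IsDominationNumber (G □ H) a → IsDominationNumber G b
    → IsDominationNumber H c
    → (a ≡ b * order H) × (b * order H ≡ c * order G)
proposition3 G H simpleG simpleH connectedG connectedH 2≤nG 2≤nH wd a b c γ□ γG γH =
  a≡b*nH , trans (sym a≡b*nH) (trans a≡nG*c (*-comm (n G) c))
  where
  a≡b*nH : a ≡ b * n H
  a≡b*nH = CartesianProduct.wellDominated⇒γ≡γˡ*n G H simpleG (connected⇒noIsolatedVertices connectedG 2≤nG) wd γ□ γG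
  a≡nG*c : a ≡ n G * c
  a≡nG*c = CartesianProduct.wellDominated⇒γ≡n*γʳ G H simpleH (connected⇒noIsolatedVertices connectedH 2≤nH) wd γ□ γH
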